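{- For $n\ge 1$ and integers $i$, let $s_{n,i}$ be the number of simple $n$-braids of length $i$ (so $s_{n,i}=0$ unless $0\le i\le n-1$). Then (a) $s_{1,0}=1$ and $s_{1,i}=0$ for $i\ne 0$; (b) for all $n\ge 2$ and $0\le i\le n-1$, $$s_{n,i}=s_{n-1,i}+s_{n-1,i-1}+s_{n-2,i-2}+\cdots+s_{n-i,0}.$$
   Context: The monoid of positive $n$-braids $\mathcal{MB}_n$ is the monoid with generators $x_1,\dots,x_{n-1}$ and relations $x_ix_j=x_jx_i$ for $|i-j|\ge 2$ and $x_ix_{i+1}x_i=x_{i+1}x_ix_{i+1}$ for $1\le i\le n-2$; word length is well defined on it. A simple braid is a positive braid $\beta\in\mathcal{MB}_n$ that can be represented by a positive word in which each letter $x_i$ occurs at most once; $\mathcal{SB}_n$ denotes the set of simple $n$-braids (including the identity, of length $0$). -}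

module Defs where

open import Data.Nat using (ℕ; zero; suc; _+_; _∸_; _<_; _≤_)
open import Data.List using (List; []; _∷_; _++_; length)
open import Data.List.Relation.Unary.All using (All)
open import Data.List.Relation.Unary.Any using (Any)
open import Data.List.Relation.Unary.AllPairs using (AllPairs)
open import Data.List.Relation.Unary.Unique.Propositional using (Unique)
open import Data.Product using (Σ; _×_)
open import Relation.Nullary using (¬_)

-- A braid word is a list of generator indices; the natural number k
-- stands for the generator x_{k+1}.  A word is an n-braid word when every
-- index k satisfies k + 1 ≤ n - 1, i.e. suc k < n.
Word : Set
Word = List ℕ

IsWord : ℕ → Word → Set
IsWord n w = All (λ k → suc k < n) w

FarApart : ℕ → ℕ → Set
FarApart a b = (2 + a ≤ b) Data.Sum.⊎ (2 + b ≤ a)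
  where import Data.Sum

-- Two positive words are equal in MB_n iff they are related by this.
data _≈_ : Word → Word → Set where
  ≈-refl  : ∀ {u} → u ≈ u
  ≈-sym   : ∀ {u v} → u ≈ v → v ≈ u
  ≈-trans : ∀ {u v w} → u ≈ v → v ≈ w → u ≈ w
  comm    : ∀ u v a b → FarApart a b →
            (u ++ a ∷ b ∷ v) ≈ (u ++ b ∷ a ∷ v)
  braid   : ∀ u v a →
            (u ++ a ∷ suc a ∷ a ∷ v) ≈ (u ++ suc a ∷ a ∷ suc a ∷ v)

SimpleWord : ℕ → Word → Set
SimpleWord n w = IsWord n w × Unique w

-- "k is the number of simple n-braids of length i":
-- there is a list of k simple words of length i which are pairwise
-- distinct as braids and such that every simple word of length i
-- represents the same braid as one of them.
-- (Every simple braid of length i is represented by a simple word, which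
-- then has length i since word length is invariant.)
IsCount : ℕ → ℕ → ℕ → Set
IsCount n i k =
  Σ (List Word) λ L →
    (length L ≡ k) ×
    All (λ w → SimpleWord n w × length w ≡ i) L ×
    AllPairs (λ u v → ¬ (u ≈ v)) L ×
    (∀ w → SimpleWord n w → length w ≡ i → Any (λ v → w ≈ v) L)
  where open import Relation.Binary.PropositionalEquality using (_≡_)

-- tailSum s n i = Σ_{j=1}^{i} s (n - j) (i - j)
--              = s_{n-1,i-1} + s_{n-2,i-2} + ... + s_{n-i,0}.
tailSum : (ℕ → ℕ → ℕ) → ℕ → ℕ → ℕ
tailSum s n zero    = 0
tailSum s n (suc i) = s (n ∸ 1) i + tailSum s (n ∸ 1) i

module Submission where

-- Generators are numbered from 0, so the letter a stands for x_{a+1} and an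
-- n-braid word uses the letters 0 … n-2.  Put M = n - 1.  A simple word
-- using its top letter M-1 is braid-equivalent to a normal form
--   w' ++ desc b k,   desc b k = (k+b) (k+b-1) … b,   k + b = M - 1,
-- where w' is a simple word on the letters below b; the normal forms are
-- listed explicitly by the mutually recursive 'normals' / 'topped', whose
-- lengths satisfy the recurrence of the proposition by construction.
-- It remains to show that the list 'normals M i' counts simple braids:
--   * soundness: its entries are simple words of length i;
--   * distinctness: braid equivalence preserves the permutation of ℕ
--     obtained by reading generators as adjacent transpositions, and any
--     two entries induce different permutations (the point M is sent to
--     the bottom b of the block, and the prefixes are separated inductively);
--   * completeness: every simple word is braid-equivalent to an entry,
--     by sinking the letters after the top letter through the block
--     ('sink') and strong induction on the number of strands.

open import Defs
open import Relation.Binary.PropositionalEquality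
  using (_≡_; _≢_; refl; sym; trans; cong; cong₂; subst; subst₂; setoid; module ≡-Reasoning)
open ≡-Reasoning
open import Data.Nat using (ℕ; zero; suc; _+_; _∸_; _≤_; _<_; s≤s; _≟_; _≤?_)
open import Data.Nat.Properties
open import Data.Nat.Induction using (<-rec)
open import Data.List using (List; []; _∷_; _++_; [_]; length; map)
open import Data.List.Properties using (++-assoc; ++-identityʳ; length-++; length-map; ∷-injectiveʳ)
open import Data.List.Relation.Unary.All as All using (All; []; _∷_)
import Data.List.Relation.Unary.All.Properties as All
open import Data.List.Relation.Unary.Any as Any using (Any; here; there)
import Data.List.Relation.Unary.Any.Properties as Any
open import Data.List.Relation.Unary.AllPairs as AllPairs using (AllPairs; []; _∷_)
import Data.List.Relation.Unary.AllPairs.Properties as AllPairs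
open import Data.List.Relation.Unary.Unique.Propositional using (Unique)
import Data.List.Relation.Unary.Unique.Propositional.Properties as Unique
open import Data.List.Relation.Binary.Disjoint.Propositional using (Disjoint)
open import Data.List.Relation.Binary.Permutation.Propositional
  using (_↭_; ↭-refl; ↭-trans; prep; ↭⇒↭ₛ)
import Data.List.Relation.Binary.Permutation.Propositional.Properties as Perm
open import Data.List.Relation.Binary.Permutation.Setoid.Properties (setoid ℕ)
  using (Unique-resp-↭)
open import Data.List.Membership.Propositional using (_∈_)
open import Data.List.Membership.Propositional.Properties using (∈-∃++)
open import Data.List.Membership.DecPropositional _≟_ using (_∈?_)
open import Data.Product using (Σ; _×_; _,_; proj₁; proj₂)
open import Data.Sum using (_⊎_; inj₁; inj₂)
open import Data.Empty using (⊥-elim)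
open import Relation.Nullary using (¬_; yes; no)
open import Relation.Binary using (tri<; tri≈; tri>)

transpose : ℕ → ℕ → ℕ
transpose zero    zero          = 1
transpose zero    (suc zero)    = 0
transpose zero    (suc (suc x)) = suc (suc x)
transpose (suc a) zero          = zero
transpose (suc a) (suc x)       = suc (transpose a x)

transpose-involutive : ∀ a x → transpose a (transpose a x) ≡ x
transpose-involutive zero    zero          = refl
transpose-involutive zero    (suc zero)    = refl
transpose-involutive zero    (suc (suc x)) = refl
transpose-involutive (suc a) zero          = refl
transpose-involutive (suc a) (suc x)       = cong suc (transpose-involutive a x)

transpose-injective : ∀ a {x y} → transpose a x ≡ transpose a y → x ≡ y
transpose-injective a {x} {y} e = begin
  x                             ≡⟨ sym (transpose-involutive a x) ⟩
  transpose a (transpose a x)   ≡⟨ cong (transpose a) e ⟩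
  transpose a (transpose a y)   ≡⟨ transpose-involutive a y ⟩
  y                             ∎

transpose-fixes : ∀ a y → suc a < y → transpose a y ≡ y
transpose-fixes zero    (suc zero)    (s≤s ())
transpose-fixes zero    (suc (suc y)) _       = refl
transpose-fixes (suc a) (suc y)       (s≤s p) = cong suc (transpose-fixes a y p)

transpose-top : ∀ a → transpose a (suc a) ≡ a
transpose-top zero    = refl
transpose-top (suc a) = cong suc (transpose-top a)

transpose-commute : ∀ a b x → 2 + a ≤ b →
                    transpose a (transpose b x) ≡ transpose b (transpose a x)
transpose-commute zero    (suc zero)    x             (s≤s ())
transpose-commute zero    (suc (suc b)) zero          _       = refl
transpose-commute zero    (suc (suc b)) (suc zero)    _       = refl
transpose-commute zero    (suc (suc b)) (suc (suc x)) _       = refl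
transpose-commute (suc a) (suc b)       zero          _       = refl
transpose-commute (suc a) (suc b)       (suc x)       (s≤s p) =
  cong suc (transpose-commute a b x p)

transpose-far : ∀ a b x → FarApart a b →
                transpose b (transpose a x) ≡ transpose a (transpose b x)
transpose-far a b x (inj₁ a+2≤b) = sym (transpose-commute a b x a+2≤b)
transpose-far a b x (inj₂ b+2≤a) = transpose-commute b a x b+2≤a

transpose-braid : ∀ a x → transpose a (transpose (suc a) (transpose a x))
                        ≡ transpose (suc a) (transpose a (transpose (suc a) x))
transpose-braid zero    zero                = refl
transpose-braid zero    (suc zero)          = refl
transpose-braid zero    (suc (suc zero))    = refl
transpose-braid zero    (suc (suc (suc x))) = refl
transpose-braid (suc a) zero                = refl
transpose-braid (suc a) (suc x)             = cong suc (transpose-braid a x)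

act : Word → ℕ → ℕ
act []      x = x
act (a ∷ w) x = act w (transpose a x)

act-++ : ∀ u v x → act (u ++ v) x ≡ act v (act u x)
act-++ []      v x = refl
act-++ (a ∷ u) v x = act-++ u v (transpose a x)

act-resp-≈ : ∀ {u v} → u ≈ v → ∀ x → act u x ≡ act v x
act-resp-≈ ≈-refl          x = refl
act-resp-≈ (≈-sym p)       x = sym (act-resp-≈ p x)
act-resp-≈ (≈-trans p q)   x = trans (act-resp-≈ p x) (act-resp-≈ q x)
act-resp-≈ (comm u v a b f) x = begin
  act (u ++ a ∷ b ∷ v) x           ≡⟨ act-++ u _ x ⟩
  act (a ∷ b ∷ v) (act u x)        ≡⟨ cong (act v) (transpose-far a b (act u x) f) ⟩
  act (b ∷ a ∷ v) (act u x)        ≡⟨ sym (act-++ u _ x) ⟩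
  act (u ++ b ∷ a ∷ v) x           ∎
act-resp-≈ (braid u v a) x = begin
  act (u ++ a ∷ suc a ∷ a ∷ v) x         ≡⟨ act-++ u _ x ⟩
  act (a ∷ suc a ∷ a ∷ v) (act u x)      ≡⟨ cong (act v) (transpose-braid a (act u x)) ⟩
  act (suc a ∷ a ∷ suc a ∷ v) (act u x)  ≡⟨ sym (act-++ u _ x) ⟩
  act (u ++ suc a ∷ a ∷ suc a ∷ v) x     ∎

act-injective : ∀ w {x y} → act w x ≡ act w y → x ≡ y
act-injective []      e = e
act-injective (a ∷ w) e = transpose-injective a (act-injective w e)

act-fixes : ∀ {m} w → All (_< m) w → ∀ y → m < y → act w y ≡ y
act-fixes []      []       y m<y = refl
act-fixes (a ∷ w) (a<m ∷ ws) y m<y =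
  trans (cong (act w) (transpose-fixes a y (≤-trans (s≤s a<m) m<y)))
        (act-fixes w ws y m<y)

Separated : Word → Word → Set
Separated u v = Σ ℕ λ x → act u x ≢ act v x

separated⇒≉ : ∀ {u v} → Separated u v → ¬ (u ≈ v)
separated⇒≉ (x , act≢) u≈v = act≢ (act-resp-≈ u≈v x)

separated-++ : ∀ {u v} d → Separated u v → Separated (u ++ d) (v ++ d)
separated-++ {u} {v} d (x , act≢) = x , λ e → act≢ (act-injective d (begin
  act d (act u x)  ≡⟨ sym (act-++ u d x) ⟩
  act (u ++ d) x   ≡⟨ e ⟩
  act (v ++ d) x   ≡⟨ act-++ v d x ⟩
  act d (act v x)  ∎))

≈-prefix : ∀ p {x y} → x ≈ y → (p ++ x) ≈ (p ++ y)
≈-prefix p ≈-refl           = ≈-refl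
≈-prefix p (≈-sym q)        = ≈-sym (≈-prefix p q)
≈-prefix p (≈-trans q r)    = ≈-trans (≈-prefix p q) (≈-prefix p r)
≈-prefix p (comm u v a b f) =
  subst₂ _≈_ (++-assoc p u _) (++-assoc p u _) (comm (p ++ u) v a b f)
≈-prefix p (braid u v a)    =
  subst₂ _≈_ (++-assoc p u _) (++-assoc p u _) (braid (p ++ u) v a)

≈-suffix : ∀ q {x y} → x ≈ y → (x ++ q) ≈ (y ++ q)
≈-suffix q ≈-refl           = ≈-refl
≈-suffix q (≈-sym r)        = ≈-sym (≈-suffix q r)
≈-suffix q (≈-trans r t)    = ≈-trans (≈-suffix q r) (≈-suffix q t)
≈-suffix q (comm u v a b f) =
  subst₂ _≈_ (sym (++-assoc u (a ∷ b ∷ v) q)) (sym (++-assoc u (b ∷ a ∷ v) q))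
         (comm u (v ++ q) a b f)
≈-suffix q (braid u v a)    =
  subst₂ _≈_ (sym (++-assoc u (a ∷ suc a ∷ a ∷ v) q))
             (sym (++-assoc u (suc a ∷ a ∷ suc a ∷ v) q))
         (braid u (v ++ q) a)

commute-past : ∀ x d v → All (λ y → FarApart y x) d → (d ++ x ∷ v) ≈ (x ∷ d ++ v)
commute-past x []      v []       = ≈-refl
commute-past x (y ∷ d) v (f ∷ fs) =
  ≈-trans (≈-prefix [ y ] (commute-past x d v fs)) (comm [] (d ++ v) y x f)

desc : ℕ → ℕ → Word
desc b zero    = b ∷ []
desc b (suc k) = suc (k + b) ∷ desc b k

desc-length : ∀ b k → length (desc b k) ≡ suc k
desc-length b zero    = refl
desc-length b (suc k) = cong suc (desc-length b k)

desc-≥ : ∀ b k → All (b ≤_) (desc b k)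
desc-≥ b zero    = ≤-refl ∷ []
desc-≥ b (suc k) = ≤-trans (m≤n+m b k) (n≤1+n _) ∷ desc-≥ b k

desc-≤ : ∀ b k → All (_≤ k + b) (desc b k)
desc-≤ b zero    = ≤-refl ∷ []
desc-≤ b (suc k) = ≤-refl ∷ All.map (λ p → ≤-trans p (n≤1+n _)) (desc-≤ b k)

desc-∋ : ∀ b k y → b ≤ y → y ≤ k + b → y ∈ desc b k
desc-∋ b zero    y b≤y y≤b = here (≤-antisym y≤b b≤y)
desc-∋ b (suc k) y b≤y y≤top with m≤n⇒m<n∨m≡n y≤top
... | inj₂ y≡top     = here y≡top
... | inj₁ (s≤s y≤) = there (desc-∋ b k y b≤y y≤)

desc-unique : ∀ b k → Unique (desc b k)
desc-unique b zero    = [] ∷ []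
desc-unique b (suc k) =
  All.map (λ y≤ top≡y → <⇒≢ (s≤s y≤) (sym top≡y)) (desc-≤ b k) ∷ desc-unique b k

desc-snoc : ∀ c k → desc (suc c) k ++ [ c ] ≡ desc c (suc k)
desc-snoc c zero    = refl
desc-snoc c (suc k) = cong₂ _∷_ (cong suc (+-suc k c)) (desc-snoc c k)

act-desc : ∀ b k → act (desc b k) (suc (k + b)) ≡ b
act-desc b zero    = transpose-top b
act-desc b (suc k) =
  trans (cong (act (desc b k)) (transpose-top (suc (k + b)))) (act-desc b k)

-- The normal forms.  'normals M i' lists the normal forms of length i on
-- the letters below M; 'topped M i' lists, as pairs (prefix , block), those
-- whose block starts at the top letter M - 1.  Such a block is either the
-- single letter M - 1 after a normal form on the letters below M - 1, or
-- M - 1 followed by a block starting at M - 2.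
join : Word × Word → Word
join (p , d) = p ++ d

extend : ℕ → Word × Word → Word × Word
extend a (p , d) = p , a ∷ d

mutual
  normals : ℕ → ℕ → List Word
  normals zero    zero    = [] ∷ []
  normals zero    (suc i) = []
  normals (suc M) i       = normals M i ++ map join (topped (suc M) i)

  topped : ℕ → ℕ → List (Word × Word)
  topped zero    i       = []
  topped (suc M) zero    = []
  topped (suc M) (suc i) =
    map (λ w → w , [ M ]) (normals M i) ++ map (extend M) (topped M i)

count : ℕ → ℕ → ℕ
count zero    i = 0
count (suc M) i = length (normals M i)

tailSum-zero : ∀ i → tailSum count 0 i ≡ 0
tailSum-zero zero    = refl
tailSum-zero (suc i) = tailSum-zero i

length-topped : ∀ M i → length (topped M i) ≡ tailSum count (suc M) i
length-topped zero    zero    = refl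
length-topped zero    (suc i) = sym (tailSum-zero i)
length-topped (suc M) zero    = refl
length-topped (suc M) (suc i) = begin
  length (map (λ w → w , [ M ]) (normals M i) ++ map (extend M) (topped M i))
    ≡⟨ length-++ (map (λ w → w , [ M ]) (normals M i)) ⟩
  length (map (λ w → w , [ M ]) (normals M i)) + length (map (extend M) (topped M i))
    ≡⟨ cong₂ _+_ (length-map _ (normals M i)) (length-map _ (topped M i)) ⟩
  length (normals M i) + length (topped M i)
    ≡⟨ cong (length (normals M i) +_) (length-topped M i) ⟩
  count (suc M) i + tailSum count (suc M) i
    ∎

count-recurrence : ∀ M i →
  count (suc (suc M)) i ≡ count (suc M) i + tailSum count (suc (suc M)) i
count-recurrence M i = begin
  length (normals M i ++ map join (topped (suc M) i))
    ≡⟨ length-++ (normals M i) ⟩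
  length (normals M i) + length (map join (topped (suc M) i))
    ≡⟨ cong (length (normals M i) +_) (length-map join (topped (suc M) i)) ⟩
  length (normals M i) + length (topped (suc M) i)
    ≡⟨ cong (length (normals M i) +_) (length-topped (suc M) i) ⟩
  count (suc M) i + tailSum count (suc (suc M)) i
    ∎

Simple : ℕ → ℕ → Word → Set
Simple M i w = All (_< M) w × Unique w × length w ≡ i

record Factored (M i : ℕ) (pd : Word × Word) : Set where
  constructor factored
  field
    bottom depth  : ℕ
    reaches-top   : suc (depth + bottom) ≡ M
    is-block      : proj₂ pd ≡ desc bottom depth
    prefix-below  : All (_< bottom) (proj₁ pd)
    prefix-unique : Unique (proj₁ pd)
    total-length  : suc (depth + length (proj₁ pd)) ≡ i

join-simple : ∀ {M i} pd → Factored (suc M) i pd → Simple (suc M) i (join pd)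
join-simple {M} (p , _) (factored b k top refl p<b p! len) =
  All.++⁺ (All.map (λ x<b → <-trans x<b b<M+1) p<b)
          (All.map (λ {y} y≤ → subst (y <_) top (s≤s y≤)) (desc-≤ b k)) ,
  Unique.++⁺ p! (desc-unique b k) disjoint ,
  (begin
    length (p ++ desc b k)           ≡⟨ length-++ p ⟩
    length p + length (desc b k)     ≡⟨ cong (length p +_) (desc-length b k) ⟩
    length p + suc k                 ≡⟨ +-suc (length p) k ⟩
    suc (length p + k)               ≡⟨ cong suc (+-comm (length p) k) ⟩
    suc (k + length p)               ≡⟨ len ⟩
    _                                ∎)
  where
  b<M+1 : b < suc M
  b<M+1 = subst (b <_) top (s≤s (m≤n+m b k))
  disjoint : Disjoint p (desc b k)
  disjoint (y∈p , y∈d) = <⇒≱ (All.lookup p<b y∈p) (All.lookup (desc-≥ b k) y∈d)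

weaken-simple : ∀ {M i w} → Simple M i w → Simple (suc M) i w
weaken-simple (w<M , w! , len) = All.map (λ p → ≤-trans p (n≤1+n _)) w<M , w! , len

mutual
  normals-simple : ∀ M i → All (Simple M i) (normals M i)
  normals-simple zero    zero    = ([] , [] , refl) ∷ []
  normals-simple zero    (suc i) = []
  normals-simple (suc M) i       =
    All.++⁺ (All.map weaken-simple (normals-simple M i))
            (All.map⁺ (All.tabulate λ {pd} pd∈ →
               join-simple pd (All.lookup (topped-factored (suc M) i) pd∈)))

  topped-factored : ∀ M i → All (Factored M i) (topped M i)
  topped-factored zero    i       = []
  topped-factored (suc M) zero    = []
  topped-factored (suc M) (suc i) =
    All.++⁺ (All.map⁺ (All.map single (normals-simple M i)))
            (All.map⁺ (All.map longer (topped-factored M i)))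
    where
    single : ∀ {w} → Simple M i w → Factored (suc M) (suc i) (w , [ M ])
    single (w<M , w! , len) = factored M 0 refl refl w<M w! (cong suc len)
    longer : ∀ {pd} → Factored M i pd → Factored (suc M) (suc i) (extend M pd)
    longer (factored b k top block p<b p! len) =
      factored b (suc k) (cong suc top) (cong₂ _∷_ (sym top) block) p<b p! (cong suc len)

-- Distinctness.  A normal form with top block ending at b sends the point M
-- to b, while a normal form on fewer letters fixes it.
act-topped : ∀ {M i} pd → (f : Factored (suc M) i pd) →
             act (join pd) (suc M) ≡ Factored.bottom f
act-topped {M} (p , _) (factored b k top refl p<b _ _) = begin
  act (p ++ desc b k) (suc M)            ≡⟨ act-++ p (desc b k) (suc M) ⟩
  act (desc b k) (act p (suc M))         ≡⟨ cong (act (desc b k)) (act-fixes p p<b (suc M) b<M+1) ⟩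
  act (desc b k) (suc M)                 ≡⟨ cong (act (desc b k)) (sym top) ⟩
  act (desc b k) (suc (k + b))           ≡⟨ act-desc b k ⟩
  b                                      ∎
  where
  b<M+1 : b < suc M
  b<M+1 = subst (b <_) top (s≤s (m≤n+m b k))

PairSeparated : Word × Word → Word × Word → Set
PairSeparated (p , d) (q , e) = (d ≢ e) ⊎ ((d ≡ e) × Separated p q)

pair-separated-join : ∀ {M i pd qe} → Factored (suc M) i pd → Factored (suc M) i qe →
                      PairSeparated pd qe → Separated (join pd) (join qe)
pair-separated-join {pd = p , d} {q , _} _ _ (inj₂ (refl , sep)) = separated-++ {p} {q} d sep
pair-separated-join {M} {pd = pd} {qe} f@(factored b k top refl _ _ _)
                    g@(factored b′ k′ top′ refl _ _ _) (inj₁ d≢e) =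
  suc M , λ e → d≢e (same-block (trans (sym (act-topped pd f)) (trans e (act-topped qe g))))
  where
  same-block : b ≡ b′ → desc b k ≡ desc b′ k′
  same-block refl = cong (desc b) (+-cancelʳ-≡ b k k′ (suc-injective (trans top (sym top′))))

simple-vs-topped : ∀ {M i w pd} → Simple M i w → Factored (suc M) i pd →
                   Separated w (join pd)
simple-vs-topped {M} {w = w} {pd} (w<M , _) f@(factored b k top _ _ _ _) =
  suc M , λ e → <⇒≢ (s≤s b≤M) (sym (begin
    suc M                 ≡⟨ sym (act-fixes w w<M (suc M) ≤-refl) ⟩
    act w (suc M)         ≡⟨ e ⟩
    act (join pd) (suc M) ≡⟨ act-topped pd f ⟩
    b                     ∎))
  where
  b≤M : b ≤ M
  b≤M = subst (b ≤_) (suc-injective top) (m≤n+m b k)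

allPairs-under : ∀ {A : Set} {P : A → Set} {Q S : A → A → Set} {xs} →
  All P xs → AllPairs Q xs → (∀ {x y} → P x → P y → Q x y → S x y) → AllPairs S xs
allPairs-under []         []         f = []
allPairs-under (px ∷ pxs) (qx ∷ qxs) f =
  All.zipWith (λ (py , q) → f px py q) (pxs , qx) ∷ allPairs-under pxs qxs f

all-across : ∀ {A B : Set} {P : A → Set} {Q : B → Set} {S : A → B → Set} {xs ys} →
  All P xs → All Q ys → (∀ {x y} → P x → Q y → S x y) → All (λ x → All (S x) ys) xs
all-across []         qys f = []
all-across (px ∷ pxs) qys f = All.map (f px) qys ∷ all-across pxs qys f

desc≢[] : ∀ b k → [] ≢ desc b k
desc≢[] b zero    ()
desc≢[] b (suc k) ()

mutual
  normals-separated : ∀ M i → AllPairs Separated (normals M i)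
  normals-separated zero    zero    = [] ∷ []
  normals-separated zero    (suc i) = []
  normals-separated (suc M) i       =
    AllPairs.++⁺ (normals-separated M i)
      (AllPairs.map⁺ (allPairs-under (topped-factored (suc M) i) (topped-separated (suc M) i)
                        (λ {pd} {qe} → pair-separated-join {pd = pd} {qe})))
      (All.map All.map⁺ (all-across (normals-simple M i) (topped-factored (suc M) i)
                          simple-vs-topped))

  topped-separated : ∀ M i → AllPairs PairSeparated (topped M i)
  topped-separated zero    i       = []
  topped-separated (suc M) zero    = []
  topped-separated (suc M) (suc i) =
    AllPairs.++⁺ (AllPairs.map⁺ (AllPairs.map (λ sep → inj₂ (refl , sep)) (normals-separated M i)))
                 (AllPairs.map⁺ (AllPairs.map (λ {pd} {qe} → extend-separated pd qe)
                                              (topped-separated M i)))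
                 (All.map⁺ (All.map All.map⁺ (all-across (normals-simple M i)
                                                         (topped-factored M i) shorter-block)))
    where
    extend-separated : ∀ pd qe → PairSeparated pd qe → PairSeparated (extend M pd) (extend M qe)
    extend-separated _ _ (inj₁ d≢e)        = inj₁ (λ e → d≢e (∷-injectiveʳ e))
    extend-separated _ _ (inj₂ (d≡e , sep)) = inj₂ (cong (M ∷_) d≡e , sep)
    shorter-block : ∀ {w pd} → Simple M i w → Factored M i pd →
                    PairSeparated (w , [ M ]) (extend M pd)
    shorter-block _ (factored b k _ refl _ _ _) = inj₁ (λ e → desc≢[] b k (∷-injectiveʳ e))

-- Completeness.  A block form of w is a braid-equivalent word
-- prefix ++ desc b k  with k + b = M that is also a rearrangement of the
-- letters of w, so that it inherits simplicity from w.
record BlockForm (M : ℕ) (w : Word) : Set where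
  constructor blockForm
  field
    prefix         : Word
    bottom depth   : ℕ
    reaches-top    : depth + bottom ≡ M
    braid-equal    : w ≈ (prefix ++ desc bottom depth)
    same-letters   : w ↭ (prefix ++ desc bottom depth)

unique-resp-↭ : ∀ {xs ys : List ℕ} → xs ↭ ys → Unique xs → Unique ys
unique-resp-↭ p = Unique-resp-↭ (↭⇒↭ₛ p)

-- Sinking: the letters v following a block move to its left, except those
-- that extend it downwards.  A letter x of v with x + 1 < bottom commutes
-- past the block; x + 1 = bottom extends it; x ≥ bottom is impossible in a
-- simple word, since x would repeat a letter of the block.
sink : ∀ v b k → Unique (desc b k ++ v) → All (_≤ k + b) v →
       BlockForm (k + b) (desc b k ++ v)
sink []      b k _ _ =
  subst (BlockForm (k + b)) (sym (++-identityʳ (desc b k))) (blockForm [] b k refl ≈-refl ↭-refl)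
sink (x ∷ v) b k dv! (x≤ ∷ v≤)
  with unique-resp-↭ (Perm.shift x (desc b k) v) dv! | <-cmp (suc x) b
... | _ ∷ rest! | tri< x+1<b _ _ = pass-left (sink v b k rest! v≤)
  where
  far : All (λ y → FarApart y x) (desc b k)
  far = All.map (λ b≤y → inj₂ (≤-trans x+1<b b≤y)) (desc-≥ b k)
  pass-left : BlockForm (k + b) (desc b k ++ v) → BlockForm (k + b) (desc b k ++ x ∷ v)
  pass-left (blockForm p b′ k′ top eq perm) =
    blockForm (x ∷ p) b′ k′ top
      (≈-trans (commute-past x (desc b k) v far) (≈-prefix [ x ] eq))
      (↭-trans (Perm.shift x (desc b k) v) (prep x perm))
... | _ | tri≈ _ refl _ =
  subst₂ BlockForm (sym (+-suc k x)) (sym extended)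
    (sink v x (suc k) (subst Unique extended dv!)
          (subst (λ top → All (_≤ top) v) (+-suc k x) v≤))
  where
  extended : desc (suc x) k ++ x ∷ v ≡ desc x (suc k) ++ v
  extended = trans (sym (++-assoc (desc (suc x) k) [ x ] v))
                   (cong (_++ v) (desc-snoc x k))
... | x-fresh ∷ _ | tri> _ _ b<x+1 =
  ⊥-elim (All.lookup x-fresh (Any.++⁺ˡ (desc-∋ b k x (≤-pred b<x+1) x≤)) refl)

unique-prefix : ∀ (p : List ℕ) {q} → Unique (p ++ q) → Unique p
unique-prefix []      _               = []
unique-prefix (x ∷ p) (x-fresh ∷ pq!) = All.++⁻ˡ p x-fresh ∷ unique-prefix p pq!

unique-suffix : ∀ (p : List ℕ) {q} → Unique (p ++ q) → Unique q
unique-suffix []      q!         = q!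
unique-suffix (x ∷ p) (_ ∷ pq!) = unique-suffix p pq!

unique-++-disjoint : ∀ (p : List ℕ) {q} → Unique (p ++ q) → Disjoint p q
unique-++-disjoint (x ∷ p) (x-fresh ∷ _)   (here refl , y∈q) = All.lookup (All.++⁻ʳ p x-fresh) y∈q refl
unique-++-disjoint (x ∷ p) (_ ∷ pq!)       (there y∈p , y∈q) = unique-++-disjoint p pq! (y∈p , y∈q)

length-join-desc : ∀ p b k → length (p ++ desc b k) ≡ suc (k + length p)
length-join-desc p b k = begin
  length (p ++ desc b k)        ≡⟨ length-++ p ⟩
  length p + length (desc b k)  ≡⟨ cong (length p +_) (desc-length b k) ⟩
  length p + suc k              ≡⟨ +-suc (length p) k ⟩
  suc (length p + k)            ≡⟨ cong suc (+-comm (length p) k) ⟩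
  suc (k + length p)            ∎

blockForm-prefix : ∀ {M} u {w} → BlockForm M w → BlockForm M (u ++ w)
blockForm-prefix u (blockForm p b k top eq perm) =
  blockForm (u ++ p) b k top
    (subst (_ ≈_) (sym (++-assoc u p (desc b k))) (≈-prefix u eq))
    (subst (_ ↭_) (sym (++-assoc u p (desc b k))) (Perm.++⁺ˡ u perm))

block-form : ∀ {M} w → All (_≤ M) w → Unique w → M ∈ w → BlockForm M w
block-form {M} w w≤ w! M∈w with ∈-∃++ M∈w
... | u , v , refl =
  blockForm-prefix u (sink v M 0 (unique-suffix u w!) (All.tail (All.++⁻ʳ u {M ∷ v} w≤)))

module _ {M w} (f : BlockForm M w) where
  open BlockForm f

  bottom≤top : bottom ≤ M
  bottom≤top = subst (bottom ≤_) reaches-top (m≤n+m bottom depth)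

  blockForm-length : length w ≡ suc (depth + length prefix)
  blockForm-length = trans (Perm.↭-length same-letters) (length-join-desc prefix bottom depth)

  prefix-simple : Unique w → Unique prefix
  prefix-simple w! = unique-prefix prefix (unique-resp-↭ same-letters w!)

  -- The prefix avoids the letters of the block, so it lies below the bottom.
  prefix-below-bottom : All (_≤ M) w → Unique w → All (_< bottom) prefix
  prefix-below-bottom w≤ w! = All.tabulate below
    where
    below : ∀ {y} → y ∈ prefix → y < bottom
    below {y} y∈p with bottom ≤? y
    ... | no  b≰y = ≰⇒> b≰y
    ... | yes b≤y = ⊥-elim (unique-++-disjoint prefix (unique-resp-↭ same-letters w!)
                             (y∈p , desc-∋ bottom depth y b≤y y≤top))
      where
      y≤top : y ≤ depth + bottom
      y≤top = subst (y ≤_) (sym reaches-top)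
                (All.lookup (Perm.All-resp-↭ same-letters w≤) (Any.++⁺ˡ y∈p))

topped-∋ : ∀ k b p → Any (p ≈_) (normals b (length p)) →
           Any (λ qd → (p ≈ proj₁ qd) × (proj₂ qd ≡ desc b k))
               (topped (suc (k + b)) (suc (k + length p)))
topped-∋ zero    b p p≈ = Any.++⁺ˡ (Any.map⁺ (Any.map (_, refl) p≈))
topped-∋ (suc k) b p p≈ =
  Any.++⁺ʳ _ (Any.map⁺ (Any.map (λ (p≈q , is-block) → p≈q , cong (suc (k + b) ∷_) is-block)
                                (topped-∋ k b p p≈)))

blockForm-topped : ∀ {M w} (f : BlockForm M w) →
  Any (BlockForm.prefix f ≈_) (normals (BlockForm.bottom f) (length (BlockForm.prefix f))) →
  Any (λ pd → w ≈ join pd) (topped (suc M) (length w))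
blockForm-topped {w = w} f@(blockForm p b k refl eq _) p≈ =
  subst (λ n → Any (λ pd → w ≈ join pd) (topped (suc (k + b)) n)) (sym (blockForm-length f))
        (Any.map equivalent (topped-∋ k b p p≈))
  where
  equivalent : ∀ {qd} → (p ≈ proj₁ qd) × (proj₂ qd ≡ desc b k) → w ≈ join qd
  equivalent (p≈q , refl) = ≈-trans eq (≈-suffix (desc b k) p≈q)

-- Completeness, by strong induction on the number of letters: a simple word
-- avoiding the top letter is handled on fewer letters, otherwise its block
-- form has a prefix on the letters below the block.
Complete : ℕ → Set
Complete M = ∀ w → All (_< M) w → Unique w → Any (w ≈_) (normals M (length w))

complete : ∀ M → Complete M
complete = <-rec Complete step
  where
  step : ∀ M → (∀ {b} → b < M → Complete b) → Complete M
  step zero    _  []      []         _  = here ≈-refl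
  step zero    _  (x ∷ w) (() ∷ _)   _
  step (suc M) ih w       w<         w! with M ∈? w
  ... | no M∉w = Any.++⁺ˡ (ih ≤-refl w (All.tabulate below-M) w!)
    where
    below-M : ∀ {y} → y ∈ w → y < M
    below-M y∈w = ≤∧≢⇒< (≤-pred (All.lookup w< y∈w)) (λ { refl → M∉w y∈w })
  ... | yes M∈w = Any.++⁺ʳ (normals M (length w)) (Any.map⁺
      (blockForm-topped f (ih (s≤s (bottom≤top f)) (BlockForm.prefix f)
                              (prefix-below-bottom f w≤ w!) (prefix-simple f w!))))
    where
    w≤ : All (_≤ M) w
    w≤ = All.map ≤-pred w<
    f : BlockForm M w
    f = block-form w w≤ w! M∈w

normals-count : ∀ M i → IsCount (suc M) i (count (suc M) i)
normals-count M i =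
  normals M i , refl ,
  All.map (λ (w<M , w! , len) → (All.map s≤s w<M , w!) , len) (normals-simple M i) ,
  AllPairs.map separated⇒≉ (normals-separated M i) ,
  λ w (w-word , w!) len →
    subst (λ j → Any (w ≈_) (normals M j)) len (complete M w (All.map ≤-pred w-word) w!)

proposition4p1 : Σ (ℕ → ℕ → ℕ) λ s →
    (∀ n i → 1 ≤ n → IsCount n i (s n i)) ×
    (s 1 0 ≡ 1) ×
    (∀ i → i ≢ 0 → s 1 i ≡ 0) ×
    (∀ n i → 2 ≤ n → i ≤ n ∸ 1 →
    s n i ≡ s (n ∸ 1) i + tailSum s n i)
proposition4p1 = count , counts , refl , one-strand , recurrence
  where
  counts : ∀ n i → 1 ≤ n → IsCount n i (count n i)
  counts (suc M) i _ = normals-count M i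
  one-strand : ∀ i → i ≢ 0 → count 1 i ≡ 0
  one-strand zero    i≢0 = ⊥-elim (i≢0 refl)
  one-strand (suc i) _   = refl
  recurrence : ∀ n i → 2 ≤ n → i ≤ n ∸ 1 → count n i ≡ count (n ∸ 1) i + tailSum count n i
  recurrence (suc zero)    i (s≤s ()) _
  recurrence (suc (suc M)) i _        _ = count-recurrence M i
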